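{- Let $\Sigma$ be an alphabet with at least two letters. There is no equivalence relation $\approx_L$ of finite index on $\mathcal{V}(C(\Sigma))$ that is a time abstract language equivalence for the class of all event-clock automata over $\Sigma$.
   Context: Fix a finite alphabet $\Sigma$. The set of event clocks is $C(\Sigma)=H(\Sigma)\cup P(\Sigma)$ where $H(\Sigma)=\{\overleftarrow{x}_\sigma\mid\sigma\in\Sigma\}$ are history clocks and $P(\Sigma)=\{\overrightarrow{x}_\sigma\mid\sigma\in\Sigma\}$ are prophecy clocks. A valuation of $C\subseteq C(\Sigma)$ is a map $v:C\to\mathbb{R}_{\ge0}\cup\{\bot\}$; $\mathcal{V}(C)$ is the set of valuations. For $d\ge 0$ such that $v(x)\ge d$ for every prophecy clock $x\in C$ with $v(x)\neq\bot$, $v+d$ is given by $(v+d)(x)=v(x)+d$ for history clocks, $(v+d)(x)=v(x)-d$ for prophecy clocks, with $\bot+d=\bot-d=\bot$. $v[x:=c]$ agrees with $v$ except that $x$ gets value $c$. A valuation is initial if all history clocks are $\bot$, final if all prophecy clocks are $\bot$. A clock constraint over $C$ is a Boolean combination of $\mathsf{true}$ and atoms $x\sim c$ with $x\in C$, $c\in\mathbb{N}$, $\sim\in\{<,>,=\}$; $v\models x\sim c$ iff $v(x)\sim c$. An event-clock automaton (ECA) is $A=(Q,q_i,\Sigma,\delta,\alpha)$ with finite location set $Q$, initial location $q_i$, finite edge set $\delta\subseteq Q\times\Sigma\times\Phi(C(\Sigma))\times Q$ ($\Phi$ = clock constraints), and accepting set $\alpha\subseteq Q$. Semantics on states $(q,v)$: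 $(q,v)\xrightarrow{t}(q,v+t)$; $(q,v)\xrightarrow{\sigma}(q',v')$ iff there is $(q,\sigma,\psi,q')\in\delta$ and a valuation $\bar v$ with $\bar v[\overrightarrow{x}_\sigma:=0]=v$, $\bar v[\overleftarrow{x}_\sigma:=0]=v'$ and $\bar v\models\psi$; $(q,v)\xrightarrow{t,\sigma}(q',v')$ iff $(q,v)\xrightarrow{t}(q,v'')\xrightarrow{\sigma}(q',v')$ for some $v''$. A timed word is $\theta=(\tau,w)$ with $w=w_0\cdots w_{n-1}\in\Sigma^*$ and $0\le\tau_0\le\cdots\le\tau_{n-1}$ reals. A $(q,v)$-run on $\theta$ is $(q_0,v_0),\dots,(q_n,v_n)$ with $(q_0,v_0)=(q,v)$ and $(q_k,v_k)\xrightarrow{t_k,w_k}(q_{k+1},v_{k+1})$ where $t_0=\tau_0$, $t_k=\tau_k-\tau_{k-1}$; it is accepting if $q_n\in\alpha$ and $v_n$ is final. $L(A,(q,v))$ is the set of timed words accepted by a $(q,v)$-run; $\mathrm{untime}(\theta)=w$, extended to languages. An equivalence ${\approx_L}\subseteq\mathcal{V}(C(\Sigma))^2$ is a time abstract language equivalence for a class $\mathcal{C}$ of ECA over $\Sigma$ iff for all $A\in\mathcal{C}$, all locations $q$ of $A$ and all $v_1\approx_L v_2$: $\mathrm{untime}(L(A,(q,v_1)))=\mathrm{untime}(L(A,(q,v_2)))$. -}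

module Defs where

open import Level using (Level; _⊔_) renaming (suc to lsuc)
open import Data.Nat using (ℕ; zero; suc)
open import Data.Fin using (Fin)
open import Data.Bool using (Bool; true)
open import Data.Maybe using (Maybe; just; nothing)
open import Data.List using (List; []; _∷_; map)
open import Data.List.Membership.Propositional using (_∈_)
open import Data.Product using (Σ; ∃; _×_; _,_; proj₁)
open import Data.Sum using (_⊎_)
open import Data.Unit using (⊤)
open import Data.Empty using (⊥)
open import Relation.Nullary using (¬_)
open import Relation.Binary.PropositionalEquality using (_≡_; _≢_)
open import Relation.Binary.Structures using (IsStrictTotalOrder; IsEquivalence)
open import Algebra.Structures using (IsCommutativeRing)

-- The real numbers, axiomatised as a (Dedekind-)complete ordered field.
-- Such a structure is unique up to isomorphism, so quantifying over all
-- of them is the same as fixing ℝ.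

record RealField : Set₁ where
  infixl 6 _+_
  infixl 7 _*_
  infix  4 _<_
  field
    Carrier : Set
    _+_ _*_ : Carrier → Carrier → Carrier
    -_      : Carrier → Carrier
    0# 1#   : Carrier
    _<_     : Carrier → Carrier → Set
    isCommutativeRing : IsCommutativeRing _≡_ _+_ _*_ -_ 0# 1#
    0≢1     : 0# ≢ 1#
    inverse : ∀ x → x ≢ 0# → Σ Carrier (λ y → x * y ≡ 1#)
    isStrictTotalOrder : IsStrictTotalOrder _≡_ _<_
    +-mono-< : ∀ x y z → x < y → x + z < y + z
    *-pos    : ∀ x y → 0# < x → 0# < y → 0# < x * y

  _≤_ : Carrier → Carrier → Set
  x ≤ y = x < y ⊎ x ≡ y

  _-_ : Carrier → Carrier → Carrier
  x - y = x + (- y)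

  field
    complete : (P : Carrier → Set) → Σ Carrier P →
               Σ Carrier (λ b → ∀ x → P x → x ≤ b) →
               Σ Carrier (λ s → (∀ x → P x → x ≤ s) ×
                                (∀ b → (∀ x → P x → x ≤ b) → s ≤ b))

  fromℕ : ℕ → Carrier
  fromℕ zero    = 0#
  fromℕ (suc n) = 1# + fromℕ n

data Clock (k : ℕ) : Set where
  history  : Fin k → Clock k
  prophecy : Fin k → Clock k

module ECA-Semantics (R : RealField) (k : ℕ) where
  open RealField R

  -- raw valuations (value ⊥ is nothing)
  RawVal : Set
  RawVal = Clock k → Maybe Carrier

  -- membership in 𝒱(C(Σ)): all defined values are ≥ 0
  NonNeg : RawVal → Set
  NonNeg v = ∀ x r → v x ≡ just r → 0# ≤ r

  Valuation : Set
  Valuation = Σ RawVal NonNeg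

  Initial : RawVal → Set
  Initial v = ∀ σ → v (history σ) ≡ nothing

  Final : RawVal → Set
  Final v = ∀ σ → v (prophecy σ) ≡ nothing

  Delay : RawVal → Carrier → RawVal → Set
  Delay v d v' =
    0# ≤ d ×
    (∀ σ → v' (history σ) ≡ Data.Maybe.map (λ r → r + d) (v (history σ))) ×
    (∀ σ → v' (prophecy σ) ≡ Data.Maybe.map (λ r → r - d) (v (prophecy σ))) ×
    (∀ σ r → v (prophecy σ) ≡ just r → d ≤ r)

  Update : RawVal → Clock k → Maybe Carrier → RawVal → Set
  Update v x c w = w x ≡ c × (∀ y → y ≢ x → w y ≡ v y)

  data Rel : Set where
    lt eq gt : Rel

  data Constraint : Set where
    ctrue : Constraint
    atom  : Clock k → Rel → ℕ → Constraint
    cnot  : Constraint → Constraint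
    cand  : Constraint → Constraint → Constraint
    cor   : Constraint → Constraint → Constraint

  relSat : Rel → Maybe Carrier → Carrier → Set
  relSat _  nothing  _ = ⊥
  relSat lt (just r) c = r < c
  relSat eq (just r) c = r ≡ c
  relSat gt (just r) c = c < r

  _⊨_ : RawVal → Constraint → Set
  v ⊨ ctrue        = ⊤
  v ⊨ atom x ∼ c   = relSat ∼ (v x) (fromℕ c)
  v ⊨ cnot ψ       = ¬ (v ⊨ ψ)
  v ⊨ cand ψ₁ ψ₂   = (v ⊨ ψ₁) × (v ⊨ ψ₂)
  v ⊨ cor ψ₁ ψ₂    = (v ⊨ ψ₁) ⊎ (v ⊨ ψ₂)

  record ECA (m : ℕ) : Set where
    field
      qᵢ : Fin m
      δ  : List (Fin m × Fin k × Constraint × Fin m)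
      α  : Fin m → Bool

  module _ {m : ℕ} (A : ECA m) where
    open ECA A

    Step : Fin m → RawVal → Fin k → Fin m → RawVal → Set
    Step q v σ q' v' =
      Σ Constraint λ ψ → ((q , σ , ψ , q') ∈ δ) ×
      Σ RawVal λ v̄ → NonNeg v̄ ×
        Update v̄ (prophecy σ) (just 0#) v ×
        Update v̄ (history σ) (just 0#) v' ×
        (v̄ ⊨ ψ)

    TimedWord : Set
    TimedWord = List (Fin k × Carrier)

    untime : TimedWord → List (Fin k)
    untime = map proj₁

    -- 0 ≤ τ₀ ≤ τ₁ ≤ …   (argument: previous timestamp)
    Monotone : Carrier → TimedWord → Set
    Monotone t []            = ⊤
    Monotone t ((_ , τ) ∷ θ) = t ≤ τ × Monotone τ θ

    IsTimedWord : TimedWord → Set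
    IsTimedWord = Monotone 0#

    -- existence of an accepting (q,v)-run on the remaining word,
    -- given the timestamp t of the previous event (0 initially)
    Accepts : Fin m → RawVal → Carrier → TimedWord → Set
    Accepts q v t [] = (α q ≡ true) × Final v
    Accepts q v t ((σ , τ) ∷ θ) =
      Σ (Fin m) λ q' → Σ RawVal λ v'' → Σ RawVal λ v' →
        Delay v (τ - t) v'' × NonNeg v'' ×
        Step q v'' σ q' v' × NonNeg v' ×
        Accepts q' v' τ θ

    InLang : Fin m → RawVal → TimedWord → Set
    InLang q v θ = IsTimedWord θ × Accepts q v 0# θ

    InUntimeLang : Fin m → RawVal → List (Fin k) → Set
    InUntimeLang q v w = Σ TimedWord λ θ → untime θ ≡ w × InLang q v θ

  IsTALE : ∀ {ℓ} → (Valuation → Valuation → Set ℓ) → Set ℓ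
  IsTALE _≈_ = ∀ (m : ℕ) (A : ECA m) (q : Fin m) (v₁ v₂ : Valuation) →
    v₁ ≈ v₂ → ∀ (w : List (Fin k)) →
      (InUntimeLang A q (proj₁ v₁) w → InUntimeLang A q (proj₁ v₂) w) ×
      (InUntimeLang A q (proj₁ v₂) w → InUntimeLang A q (proj₁ v₁) w)

  FiniteIndex : ∀ {ℓ} → (Valuation → Valuation → Set ℓ) → Set ℓ
  FiniteIndex _≈_ = Σ ℕ λ n → Σ (Fin n → Valuation) λ rep →
                      ∀ v → Σ (Fin n) λ i → v ≈ rep i

-- Let vₐ be the valuation with ←x_σ₀ = a and →x_σ₀ = 0 (all other clocks ⊥),
-- and let A_b be the one-location automaton reading σ₀ under the guard
-- ←x_σ₀ < b.  From vₐ the word σ₀ is accepted by A_b iff a < b: since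
-- →x_σ₀ = 0 it must be read at once, and history clocks never decrease.
-- So for i < j the valuations vᵢ and vⱼ have different untimed languages
-- in A_j, while an equivalence of index n identifies two of v₀, …, vₙ.
module Submission where

open import Defs
open import Level using (Level)
open import Data.Nat using (ℕ; _≤_)
open import Data.Product using (Σ; _×_)
open import Relation.Nullary using (¬_)
open import Relation.Binary.Structures using (IsEquivalence)

import Data.Nat as ℕ
import Data.Nat.Properties as ℕ
open import Data.Fin using (Fin; zero; suc; toℕ)
open import Data.Fin.Properties using (pigeonhole)
open import Data.Bool using (true)
open import Data.Maybe using (just; nothing)
open import Data.Maybe.Properties using (map-id; map-cong)
open import Data.List using ([]; _∷_)
open import Data.List.Relation.Unary.Any using (here)
open import Data.Product using (_,_; proj₁; proj₂)
open import Data.Sum using (inj₁; inj₂)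
open import Data.Unit using (tt)
open import Data.Empty using (⊥-elim)
open import Relation.Binary.PropositionalEquality
open import Relation.Binary.Definitions using (tri<; tri≈; tri>)
open import Relation.Binary.Structures using (IsStrictTotalOrder)
open import Algebra.Structures using (IsCommutativeRing)
open import Algebra.Bundles using (Ring)
import Algebra.Properties.Ring as RingProperties

module OrderedFieldProperties (R : RealField) where
  open RealField R renaming (_≤_ to _≤ᵣ_)
  open IsCommutativeRing isCommutativeRing
    using (+-identityˡ; +-identityʳ; +-comm; -‿inverseʳ; isRing)
  open IsStrictTotalOrder isStrictTotalOrder using (compare; irrefl)
    renaming (trans to <-trans)

  ring : Ring _ _
  ring = record { isRing = isRing }

  open RingProperties ring using (-1*x≈-x; -‿involutive; -0#≈0#)

  <-irrefl : ∀ {x} → ¬ (x < x)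
  <-irrefl = irrefl refl

  x-0≡x : ∀ x → x - 0# ≡ x
  x-0≡x x = trans (cong (x +_) -0#≈0#) (+-identityʳ x)

  -- from 1 < 0 we get 0 < -1, hence 0 < (-1)·(-1) = 1
  1≮0 : ¬ (1# < 0#)
  1≮0 1<0 = <-irrefl (<-trans 1<0 0<[-1]*[-1])
    where
    0<-1 : 0# < - 1#
    0<-1 = subst₂ _<_ (-‿inverseʳ 1#) (+-identityˡ (- 1#)) (+-mono-< 1# 0# (- 1#) 1<0)
    0<[-1]*[-1] : 0# < 1#
    0<[-1]*[-1] = subst (0# <_) (trans (-1*x≈-x (- 1#)) (-‿involutive 1#)) (*-pos _ _ 0<-1 0<-1)

  0<1 : 0# < 1#
  0<1 with compare 0# 1#
  ... | tri< 0<1 _ _ = 0<1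
  ... | tri≈ _ 0≡1 _ = ⊥-elim (0≢1 0≡1)
  ... | tri> _ _ 1<0 = ⊥-elim (1≮0 1<0)

  x<x+d : ∀ x d → 0# < d → x < x + d
  x<x+d x d 0<d = subst₂ _<_ (+-identityˡ x) (+-comm d x) (+-mono-< 0# d x 0<d)

  x+d≮x : ∀ x d → 0# ≤ᵣ d → ¬ (x + d < x)
  x+d≮x x d (inj₁ 0<d) x+d<x = <-irrefl (<-trans (x<x+d x d 0<d) x+d<x)
  x+d≮x x d (inj₂ refl) x+0<x = <-irrefl (subst (_< x) (+-identityʳ x) x+0<x)

  fromℕ-<-suc : ∀ n → fromℕ n < fromℕ (ℕ.suc n)
  fromℕ-<-suc n = subst (_< 1# + fromℕ n) (+-identityˡ (fromℕ n)) (+-mono-< 0# 1# (fromℕ n) 0<1)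

  fromℕ-mono-< : ∀ {a b} → a ℕ.< b → fromℕ a < fromℕ b
  fromℕ-mono-< {a} {ℕ.suc b} (ℕ.s≤s a≤b) with ℕ.m≤n⇒m<n∨m≡n a≤b
  ... | inj₁ a<b  = <-trans (fromℕ-mono-< a<b) (fromℕ-<-suc b)
  ... | inj₂ refl = fromℕ-<-suc a

  fromℕ-nonneg : ∀ n → 0# ≤ᵣ fromℕ n
  fromℕ-nonneg ℕ.zero    = inj₂ refl
  fromℕ-nonneg (ℕ.suc n) = inj₁ (fromℕ-mono-< {0} {ℕ.suc n} (ℕ.s≤s ℕ.z≤n))

module SemanticsProperties (R : RealField) (k : ℕ) where
  open RealField R using (0#; isCommutativeRing)
  open ECA-Semantics R k
  open OrderedFieldProperties R using (x-0≡x)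
  open IsCommutativeRing isCommutativeRing using (+-identityʳ)

  delay-zero : ∀ {v} → NonNeg v → Delay v 0# v
  delay-zero {v} v≥0 =
    inj₂ refl ,
    (λ σ → sym (trans (map-cong +-identityʳ (v (history σ))) (map-id _))) ,
    (λ σ → sym (trans (map-cong x-0≡x (v (prophecy σ))) (map-id _))) ,
    (λ σ → v≥0 (prophecy σ))

  finiteIndex⇒collision : ∀ {ℓ} {_≈_ : Valuation → Valuation → Set ℓ} →
    IsEquivalence _≈_ → FiniteIndex _≈_ → (f : ℕ → Valuation) →
    Σ ℕ λ i → Σ ℕ λ j → i ℕ.< j × f i ≈ f j
  finiteIndex⇒collision {_≈_ = _≈_} isEquivalence (n , rep , classOf) f
    with i , j , i<j , sameClass ← pigeonhole (ℕ.n<1+n n) (λ i → proj₁ (classOf (f (toℕ i))))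
    = toℕ i , toℕ j , i<j , ≈-trans fᵢ≈rep (≈-sym fⱼ≈rep)
    where
    open IsEquivalence isEquivalence renaming (trans to ≈-trans; sym to ≈-sym)
    fᵢ≈rep : f (toℕ i) ≈ rep (proj₁ (classOf (f (toℕ i))))
    fᵢ≈rep = proj₂ (classOf (f (toℕ i)))
    fⱼ≈rep : f (toℕ j) ≈ rep (proj₁ (classOf (f (toℕ i))))
    fⱼ≈rep = subst (λ c → f (toℕ j) ≈ rep c) (sym sameClass) (proj₂ (classOf (f (toℕ j))))

module Counterexample (R : RealField) (k' : ℕ) where
  open RealField R using (0#; _+_; _-_; fromℕ)
  open ECA-Semantics R (ℕ.suc k')
  open OrderedFieldProperties R using (x-0≡x; x+d≮x; fromℕ-mono-<; fromℕ-nonneg)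
  open SemanticsProperties R (ℕ.suc k') using (delay-zero)

  σ₀ : Fin (ℕ.suc k')
  σ₀ = zero

  -- ←x_σ₀ = a and →x_σ₀ = 0: σ₀ occurred a time units ago and occurs again now
  val : ℕ → RawVal
  val a (history zero)     = just (fromℕ a)
  val a (prophecy zero)    = just 0#
  val a (history (suc _))  = nothing
  val a (prophecy (suc _)) = nothing

  val-nonneg : ∀ a → NonNeg (val a)
  val-nonneg a (history zero) _ refl = fromℕ-nonneg a
  val-nonneg a (prophecy zero) _ refl = inj₂ refl

  valuation : ℕ → Valuation
  valuation a = val a , val-nonneg a

  -- the valuation v̄ at which the guard is checked when σ₀ is read from val a
  val-at-read : ℕ → RawVal
  val-at-read a (history zero) = just (fromℕ a)
  val-at-read a _              = nothing

  val-at-read-nonneg : ∀ a → NonNeg (val-at-read a)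
  val-at-read-nonneg a (history zero) _ refl = fromℕ-nonneg a

  val-after-read : RawVal
  val-after-read (history zero) = just 0#
  val-after-read _              = nothing

  val-after-read-nonneg : NonNeg val-after-read
  val-after-read-nonneg (history zero) _ refl = inj₂ refl

  guarded : ℕ → ECA 1
  guarded b = record
    { qᵢ = zero
    ; δ  = (zero , σ₀ , atom (history σ₀) lt b , zero) ∷ []
    ; α  = λ _ → true
    }

  guarded-accepts : ∀ {a b} → a ℕ.< b → InUntimeLang (guarded b) zero (val a) (σ₀ ∷ [])
  guarded-accepts {a} {b} a<b =
    (σ₀ , 0#) ∷ [] , refl , (inj₂ refl , tt) ,
    zero , val a , val-after-read ,
    subst (λ d → Delay (val a) d (val a)) (sym (x-0≡x 0#)) (delay-zero (val-nonneg a)) ,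
    val-nonneg a ,
    (_ , here refl , val-at-read a , val-at-read-nonneg a ,
     at-read-then-due , at-read-then-after , fromℕ-mono-< a<b) ,
    val-after-read-nonneg , refl , (λ _ → refl)
    where
    at-read-then-due : Update (val-at-read a) (prophecy σ₀) (just 0#) (val a)
    at-read-then-due = refl , λ
      { (history zero)     _   → refl
      ; (history (suc _))  _   → refl
      ; (prophecy zero)    x≢x → ⊥-elim (x≢x refl)
      ; (prophecy (suc _)) _   → refl
      }
    at-read-then-after : Update (val-at-read a) (history σ₀) (just 0#) val-after-read
    at-read-then-after = refl , λ
      { (history zero)    x≢x → ⊥-elim (x≢x refl)
      ; (history (suc _)) _   → refl
      ; (prophecy _)      _   → refl
      }

  -- the guard ←x_σ₀ < b fails since ←x_σ₀ has already reached b and only grows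
  guarded-rejects : ∀ b w → ¬ InUntimeLang (guarded b) zero (val b) w
  guarded-rejects b w ([] , _ , _ , _ , final) with final zero
  ... | ()
  guarded-rejects b w ((_ , τ) ∷ _ , _ , _ ,
      _ , _ , _ , (τ≥0 , delayed , _) , _ ,
      (_ , here refl , v̄ , _ , (_ , unchanged) , _ , guard) , _) =
    x+d≮x (fromℕ b) (τ - 0#) τ≥0 (subst (λ x → relSat lt x (fromℕ b)) history-at-read guard)
    where
    history-at-read : v̄ (history σ₀) ≡ just (fromℕ b + (τ - 0#))
    history-at-read = trans (sym (unchanged (history σ₀) (λ ()))) (delayed σ₀)

-- Only one letter is needed: the hypothesis 2 ≤ k merely makes Σ nonempty.
proposition1 : ∀ {ℓ : Level} (R : RealField) (k : ℕ) → 2 ≤ k →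
    let open ECA-Semantics R k in
    ¬ (Σ (Valuation → Valuation → Set ℓ) λ _≈_ →
    IsEquivalence _≈_ × FiniteIndex _≈_ × IsTALE _≈_)
proposition1 R (ℕ.suc k') _ (_≈_ , isEquivalence , finite , tale)
  = let i , j , i<j , vᵢ≈vⱼ = finiteIndex⇒collision isEquivalence finite valuation
        accepted-from-vⱼ = proj₁ (tale 1 (guarded j) zero (valuation i) (valuation j) vᵢ≈vⱼ (σ₀ ∷ []))
    in guarded-rejects j (σ₀ ∷ []) (accepted-from-vⱼ (guarded-accepts i<j))
  where
  open SemanticsProperties R (ℕ.suc k') using (finiteIndex⇒collision)
  open Counterexample R k'
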